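{- Let $G=(X,Y,E)$ be a bipartite graph with positive integer edge weights $w$ and largest edge weight $N$, and let $h\in[1,N]$ be an integer. Let $G_h$ be the graph formed by the edges $uv$ of $G$ with $w(u,v)\in[N-h+1,N]$, each with weight $w(u,v)-(N-h)$; let $C_h$ be a minimum weight cover of $G_h$ (with $C_h=0$ on nodes of $G$ not in $G_h$); let $G^{\Delta}_h$ be the graph formed by the edges $uv$ of $G$ with $w(u,v)-C_h(u)-C_h(v)>0$, each with weight $w(u,v)-C_h(u)-C_h(v)$; and let $C^{\Delta}_h$ be any minimum weight cover of $G^{\Delta}_h$ (with $C^{\Delta}_h=0$ on nodes of $G$ not in $G^{\Delta}_h$). If $D$ is the function on $X\cup Y$ given by $D(u)=C_h(u)+C^{\Delta}_h(u)$, then $D$ is a minimum weight cover of $G$.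
   Context: Set $w(u,v)=0$ for non-adjacent $u,v$. A cover of a bipartite graph with sides $X,Y$ is a function $C:X\cup Y\to\{0,1,2,\ldots\}$ with $C(x)+C(y)\ge w(x,y)$ for all $x\in X,y\in Y$; its weight is $\sum_z C(z)$; a minimum weight cover is one of minimum weight. -}

module Defs where

open import Data.Nat using (ℕ; zero; suc; _+_; _∸_; _≤_; _<_; _⊔_)
open import Data.Fin using (Fin)
open import Data.Product using (_×_)
open import Relation.Binary.PropositionalEquality using (_≡_)

∑ : (k : ℕ) → (Fin k → ℕ) → ℕ
∑ zero    f = 0
∑ (suc k) f = f Fin.zero + ∑ k (λ i → f (Fin.suc i))

maxF : (k : ℕ) → (Fin k → ℕ) → ℕ
maxF zero    f = 0
maxF (suc k) f = f Fin.zero ⊔ maxF k (λ i → f (Fin.suc i))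

-- A weighted bipartite graph with sides X = Fin m, Y = Fin n is given by
-- w : Fin m → Fin n → ℕ, where w x y = 0 means x, y are non-adjacent and
-- w x y > 0 means xy is an edge of weight w x y (so edge weights are positive).
Weights : ℕ → ℕ → Set
Weights m n = Fin m → Fin n → ℕ

record NodeFun (m n : ℕ) : Set where
  constructor _,_
  field
    onX : Fin m → ℕ
    onY : Fin n → ℕ
open NodeFun public

IsCover : {m n : ℕ} → Weights m n → NodeFun m n → Set
IsCover w C = ∀ x y → w x y ≤ onX C x + onY C y

weight : {m n : ℕ} → NodeFun m n → ℕ
weight {m} {n} C = ∑ m (onX C) + ∑ n (onY C)

IsMinCover : {m n : ℕ} → Weights m n → NodeFun m n → Set
IsMinCover w C = IsCover w C × (∀ C' → IsCover w C' → weight C ≤ weight C')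

maxWeight : {m n : ℕ} → Weights m n → ℕ
maxWeight {m} {n} w = maxF m (λ x → maxF n (λ y → w x y))

IsolatedX : {m n : ℕ} → Weights m n → Fin m → Set
IsolatedX w x = ∀ y → w x y ≡ 0

IsolatedY : {m n : ℕ} → Weights m n → Fin n → Set
IsolatedY w y = ∀ x → w x y ≡ 0

-- G_h: edges uv with w(u,v) ∈ [N-h+1, N], weight w(u,v) - (N-h).
-- (For 1 ≤ h ≤ N, w ≥ N-h+1 iff w ∸ (N ∸ h) > 0, and then the weight is w - (N-h).)
Gh : {m n : ℕ} → Weights m n → ℕ → Weights m n
Gh w h x y = w x y ∸ (maxWeight w ∸ h)

-- G^Δ_h: edges uv with w(u,v) - C(u) - C(v) > 0, with that weight
-- (truncated subtraction gives 0, i.e. non-adjacent, otherwise).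
GΔ : {m n : ℕ} → Weights m n → NodeFun m n → Weights m n
GΔ w C x y = w x y ∸ (onX C x + onY C y)

_⊕_ : {m n : ℕ} → NodeFun m n → NodeFun m n → NodeFun m n
C ⊕ C' = (λ x → onX C x + onX C' x) , (λ y → onY C y + onY C' y)

{-# OPTIONS --safe #-}
-- For a cover A of G that is pointwise above C_h, A − C_h covers G^Δ_h, so weight C_h +
-- weight C^Δ_h ≤ weight A; it therefore suffices to replace any cover C of G by a no heavier
-- cover above C_h. With t = N − h, adding t to C_h on Y gives a cover R of G. The covers
-- (max on X, min on Y) and (min on X, max on Y) of C and R have weights summing to
-- weight C + weight R, and the second is ≥ t on Y, so by the same argument (with the constant
-- t in place of C_h, and C_h as the minimum cover of G minus t) it weighs at least weight R.
-- Hence the first is no heavier than C, and it is above C_h on X. Repeating this with X and Y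
-- exchanged also makes it above C_h on Y, while the minimum taken on X stays above C_h.
module Submission where

open import Defs
open import Data.Fin using (Fin; zero; suc)
open import Data.Nat using (ℕ; zero; suc; _+_; _∸_; _≤_; _⊔_; _⊓_; z≤n)
open import Data.Nat.Properties
open import Algebra.Properties.CommutativeSemigroup +-commutativeSemigroup using (interchange)
open import Data.Product using (Σ-syntax; _×_; _,_; proj₁)
open import Data.Sum using (inj₁; inj₂)
open import Relation.Binary.PropositionalEquality
  using (_≡_; refl; cong; cong₂; trans; subst; module ≡-Reasoning)

∑-cong : ∀ k {f g : Fin k → ℕ} → (∀ i → f i ≡ g i) → ∑ k f ≡ ∑ k g
∑-cong zero    f≗g = refl
∑-cong (suc k) f≗g = cong₂ _+_ (f≗g zero) (∑-cong k (λ i → f≗g (suc i)))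

∑-distrib-+ : ∀ k (f g : Fin k → ℕ) → ∑ k (λ i → f i + g i) ≡ ∑ k f + ∑ k g
∑-distrib-+ zero    f g = refl
∑-distrib-+ (suc k) f g =
  trans (cong (f zero + g zero +_) (∑-distrib-+ k (λ i → f (suc i)) (λ i → g (suc i))))
        (interchange (f zero) (g zero) _ _)

m⊔n+m⊓n≡m+n : ∀ m n → (m ⊔ n) + (m ⊓ n) ≡ m + n
m⊔n+m⊓n≡m+n m n with ≤-total m n
... | inj₁ m≤n = trans (cong₂ _+_ (m≤n⇒m⊔n≡n m≤n) (m≤n⇒m⊓n≡m m≤n)) (+-comm n m)
... | inj₂ n≤m = cong₂ _+_ (m≥n⇒m⊔n≡m n≤m) (m≥n⇒m⊓n≡n n≤m)

module _ {m n : ℕ} where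

  infix 4 _≤ᴺ_

  _≤ᴺ_ : NodeFun m n → NodeFun m n → Set
  C ≤ᴺ D = (∀ x → onX C x ≤ onX D x) × (∀ y → onY C y ≤ onY D y)

  _∸ᴺ_ _⊔⊓_ _⊓⊔_ : NodeFun m n → NodeFun m n → NodeFun m n
  C ∸ᴺ D = (λ x → onX C x ∸ onX D x) , (λ y → onY C y ∸ onY D y)
  C ⊔⊓ D = (λ x → onX C x ⊔ onX D x) , (λ y → onY C y ⊓ onY D y)
  C ⊓⊔ D = (λ x → onX C x ⊓ onX D x) , (λ y → onY C y ⊔ onY D y)

  _∸ᵂ_ : Weights m n → ℕ → Weights m n
  (w ∸ᵂ t) x y = w x y ∸ t

  -- t sits on Y so that GΔ w (constY t) is definitionally w ∸ᵂ t: 0 + t reduces, t + 0 does not.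
  constY : ℕ → NodeFun m n
  constY t = (λ _ → 0) , (λ _ → t)

  weight-cong : {C D : NodeFun m n} →
    (∀ x → onX C x ≡ onX D x) → (∀ y → onY C y ≡ onY D y) → weight C ≡ weight D
  weight-cong C≗D₁ C≗D₂ = cong₂ _+_ (∑-cong m C≗D₁) (∑-cong n C≗D₂)

  weight-⊕ : (C D : NodeFun m n) → weight (C ⊕ D) ≡ weight C + weight D
  weight-⊕ C D =
    trans (cong₂ _+_ (∑-distrib-+ m (onX C) (onX D)) (∑-distrib-+ n (onY C) (onY D)))
          (interchange (∑ m (onX C)) (∑ m (onX D)) (∑ n (onY C)) (∑ n (onY D)))

  weight-⊕-∸ᴺ : {C A : NodeFun m n} → C ≤ᴺ A → weight (C ⊕ (A ∸ᴺ C)) ≡ weight A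
  weight-⊕-∸ᴺ (C≤A₁ , C≤A₂) =
    weight-cong (λ x → m+[n∸m]≡n (C≤A₁ x)) (λ y → m+[n∸m]≡n (C≤A₂ y))

  weight-⊔⊓+⊓⊔ : (C D : NodeFun m n) →
    weight (C ⊔⊓ D) + weight (C ⊓⊔ D) ≡ weight C + weight D
  weight-⊔⊓+⊓⊔ C D = begin
    weight (C ⊔⊓ D) + weight (C ⊓⊔ D) ≡⟨ weight-⊕ (C ⊔⊓ D) (C ⊓⊔ D) ⟨
    weight ((C ⊔⊓ D) ⊕ (C ⊓⊔ D))      ≡⟨ weight-cong ⊔+⊓ ⊓+⊔ ⟩
    weight (C ⊕ D)                    ≡⟨ weight-⊕ C D ⟩
    weight C + weight D               ∎
    where
    open ≡-Reasoning
    ⊔+⊓ : ∀ x → (onX C x ⊔ onX D x) + (onX C x ⊓ onX D x) ≡ onX C x + onX D x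
    ⊔+⊓ x = m⊔n+m⊓n≡m+n (onX C x) (onX D x)
    ⊓+⊔ : ∀ y → (onY C y ⊓ onY D y) + (onY C y ⊔ onY D y) ≡ onY C y + onY D y
    ⊓+⊔ y = trans (+-comm (onY C y ⊓ onY D y) _) (m⊔n+m⊓n≡m+n (onY C y) (onY D y))

  module _ {w : Weights m n} where

    ⊕-cover : {C D : NodeFun m n} → IsCover (GΔ w C) D → IsCover w (C ⊕ D)
    ⊕-cover {C} {D} D-cover x y = begin
      w x y                   ≤⟨ m≤n+m∸n (w x y) (a + b) ⟩
      (a + b) + GΔ w C x y    ≤⟨ +-monoʳ-≤ (a + b) (D-cover x y) ⟩
      (a + b) + (c + d)       ≡⟨ interchange a b c d ⟩
      (a + c) + (b + d)       ∎
      where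
      open ≤-Reasoning
      a b c d : ℕ
      a = onX C x; b = onY C y; c = onX D x; d = onY D y

    constY-⊕-cover : {t : ℕ} {C : NodeFun m n} → IsCover (w ∸ᵂ t) C → IsCover w (constY t ⊕ C)
    constY-⊕-cover {t} {C} = ⊕-cover {C = constY t} {C}

    ∸ᴺ-cover : {C A : NodeFun m n} → IsCover w A → C ≤ᴺ A → IsCover (GΔ w C) (A ∸ᴺ C)
    ∸ᴺ-cover {C} {A} A-cover (C≤A₁ , C≤A₂) x y = m≤n+o⇒m∸n≤o (w x y) (c + d) (begin
      w x y                             ≤⟨ A-cover x y ⟩
      a + b                             ≡⟨ cong₂ _+_ (m+[n∸m]≡n (C≤A₁ x)) (m+[n∸m]≡n (C≤A₂ y)) ⟨
      (c + (a ∸ c)) + (d + (b ∸ d))     ≡⟨ interchange c (a ∸ c) d (b ∸ d) ⟩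
      (c + d) + ((a ∸ c) + (b ∸ d))     ∎)
      where
      open ≤-Reasoning
      a b c d : ℕ
      a = onX A x; b = onY A y; c = onX C x; d = onY C y

    ⊕-minimal-above : {C D A : NodeFun m n} → IsMinCover (GΔ w C) D →
      IsCover w A → C ≤ᴺ A → weight (C ⊕ D) ≤ weight A
    ⊕-minimal-above {C} {D} {A} (_ , D-min) A-cover C≤A = begin
      weight (C ⊕ D)             ≡⟨ weight-⊕ C D ⟩
      weight C + weight D        ≤⟨ +-monoʳ-≤ (weight C) (D-min (A ∸ᴺ C) (∸ᴺ-cover A-cover C≤A)) ⟩
      weight C + weight (A ∸ᴺ C) ≡⟨ weight-⊕ C (A ∸ᴺ C) ⟨
      weight (C ⊕ (A ∸ᴺ C))      ≡⟨ weight-⊕-∸ᴺ C≤A ⟩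
      weight A                   ∎
      where open ≤-Reasoning

    ⊔⊓-cover : {C D : NodeFun m n} → IsCover w C → IsCover w D → IsCover w (C ⊔⊓ D)
    ⊔⊓-cover {C} {D} C-cover D-cover x y = begin
      w x y                             ≤⟨ ⊓-glb (≤-trans (C-cover x y) (+-monoˡ-≤ b (m≤m⊔n a c)))
                                                 (≤-trans (D-cover x y) (+-monoˡ-≤ d (m≤n⊔m a c))) ⟩
      ((a ⊔ c) + b) ⊓ ((a ⊔ c) + d)     ≡⟨ +-distribˡ-⊓ (a ⊔ c) b d ⟨
      (a ⊔ c) + (b ⊓ d)                 ∎
      where
      open ≤-Reasoning
      a b c d : ℕ
      a = onX C x; b = onY C y; c = onX D x; d = onY D y

transpose : {m n : ℕ} → Weights m n → Weights n m
transpose w y x = w x y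

swapSides : {m n : ℕ} → NodeFun m n → NodeFun n m
swapSides C = onY C , onX C

weight-swapSides : {m n : ℕ} (C : NodeFun m n) → weight (swapSides C) ≡ weight C
weight-swapSides {m} {n} C = +-comm (∑ n (onY C)) (∑ m (onX C))

swapSides-cover : {m n : ℕ} {w : Weights m n} {C : NodeFun m n} →
  IsCover w C → IsCover (transpose w) (swapSides C)
swapSides-cover {w = w} {C} C-cover y x =
  subst (w x y ≤_) (+-comm (onX C x) (onY C y)) (C-cover x y)

swapSides-minCover : {m n : ℕ} {w : Weights m n} {C : NodeFun m n} →
  IsMinCover w C → IsMinCover (transpose w) (swapSides C)
swapSides-minCover {C = C} (C-cover , C-min) =
  swapSides-cover {C = C} C-cover , λ C′ C′-cover → begin
    weight (swapSides C)  ≡⟨ weight-swapSides C ⟩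
    weight C              ≤⟨ C-min (swapSides C′) (swapSides-cover {C = C′} C′-cover) ⟩
    weight (swapSides C′) ≡⟨ weight-swapSides C′ ⟩
    weight C′             ∎
  where open ≤-Reasoning

⊓⊔-cover : {m n : ℕ} {w : Weights m n} {C D : NodeFun m n} →
  IsCover w C → IsCover w D → IsCover w (C ⊓⊔ D)
⊓⊔-cover {C = C} {D} C-cover D-cover =
  swapSides-cover {C = swapSides C ⊔⊓ swapSides D}
    (⊔⊓-cover {C = swapSides C} {swapSides D}
      (swapSides-cover {C = C} C-cover) (swapSides-cover {C = D} D-cover))

uncross-weight : {m n : ℕ} {w : Weights m n} {t : ℕ} {Ch C : NodeFun m n} →
  IsMinCover (w ∸ᵂ t) Ch → IsCover w C → weight (C ⊔⊓ (constY t ⊕ Ch)) ≤ weight C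
uncross-weight {m} {n} {t = t} {Ch} {C} Ch-min C-cover =
  +-cancelʳ-≤ (weight (C ⊓⊔ R)) _ _ (begin
    weight (C ⊔⊓ R) + weight (C ⊓⊔ R) ≡⟨ weight-⊔⊓+⊓⊔ C R ⟩
    weight C + weight R               ≤⟨ +-monoʳ-≤ (weight C) R-lightest ⟩
    weight C + weight (C ⊓⊔ R)        ∎)
  where
  open ≤-Reasoning
  R : NodeFun m n
  R = constY t ⊕ Ch
  R-lightest : weight R ≤ weight (C ⊓⊔ R)
  R-lightest = ⊕-minimal-above Ch-min
    (⊓⊔-cover {C = C} C-cover (constY-⊕-cover {C = Ch} (proj₁ Ch-min)))
    ((λ _ → z≤n) , (λ y → ≤-trans (m≤m+n t (onY Ch y)) (m≤n⊔m (onY C y) (t + onY Ch y))))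

cover-above : {m n : ℕ} {w : Weights m n} {t : ℕ} {Ch C : NodeFun m n} →
  IsMinCover (w ∸ᵂ t) Ch → IsCover w C →
  Σ[ A ∈ NodeFun m n ] IsCover w A × weight A ≤ weight C × Ch ≤ᴺ A
cover-above {m} {n} {w} {t} {Ch} {C} Ch-min C-cover =
  swapSides L′ , swapSides-cover {C = L′} L′-cover , A≤C , Ch≤A
  where
  open ≤-Reasoning
  L : NodeFun m n
  L = C ⊔⊓ (constY t ⊕ Ch)
  L-cover : IsCover w L
  L-cover = ⊔⊓-cover {C = C} C-cover (constY-⊕-cover {C = Ch} (proj₁ Ch-min))
  swapped-min : IsMinCover (transpose w ∸ᵂ t) (swapSides Ch)
  swapped-min = swapSides-minCover Ch-min
  L′ : NodeFun n m
  L′ = swapSides L ⊔⊓ (constY t ⊕ swapSides Ch)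
  L′-cover : IsCover (transpose w) L′
  L′-cover = ⊔⊓-cover {C = swapSides L} (swapSides-cover {C = L} L-cover)
    (constY-⊕-cover {C = swapSides Ch} (proj₁ swapped-min))
  A≤C : weight (swapSides L′) ≤ weight C
  A≤C = begin
    weight (swapSides L′) ≡⟨ weight-swapSides L′ ⟩
    weight L′             ≤⟨ uncross-weight swapped-min (swapSides-cover {C = L} L-cover) ⟩
    weight (swapSides L)  ≡⟨ weight-swapSides L ⟩
    weight L              ≤⟨ uncross-weight Ch-min C-cover ⟩
    weight C              ∎
  Ch≤A : Ch ≤ᴺ swapSides L′
  Ch≤A = (λ x → ⊓-glb (m≤n⊔m (onX C x) (onX Ch x)) (m≤n+m (onX Ch x) t))
       , (λ y → m≤n⊔m (onY L y) (onY Ch y))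

⊕-minCover : {m n : ℕ} {w : Weights m n} (t : ℕ) {Ch CΔ : NodeFun m n} →
  IsMinCover (w ∸ᵂ t) Ch → IsMinCover (GΔ w Ch) CΔ → IsMinCover w (Ch ⊕ CΔ)
⊕-minCover t {Ch} {CΔ} Ch-min CΔ-min@(CΔ-cover , _) =
  ⊕-cover {C = Ch} {CΔ} CΔ-cover , λ C C-cover →
    let (A , A-cover , A≤C , Ch≤A) = cover-above {t = t} Ch-min C-cover
    in ≤-trans (⊕-minimal-above CΔ-min A-cover Ch≤A) A≤C

-- Neither the range of h nor the convention that C_h and C^Δ_h vanish off their graphs is needed.
lemma3p1 : (m n : ℕ) (w : Weights m n) (h : ℕ)
    → 1 ≤ h → h ≤ maxWeight w
    → (Ch : NodeFun m n) → IsMinCover (Gh w h) Ch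
    → (∀ x → IsolatedX (Gh w h) x → onX Ch x ≡ 0)
    → (∀ y → IsolatedY (Gh w h) y → onY Ch y ≡ 0)
    → (CΔ : NodeFun m n) → IsMinCover (GΔ w Ch) CΔ
    → (∀ x → IsolatedX (GΔ w Ch) x → onX CΔ x ≡ 0)
    → (∀ y → IsolatedY (GΔ w Ch) y → onY CΔ y ≡ 0)
    → IsMinCover w (Ch ⊕ CΔ)
lemma3p1 _ _ w h _ _ _ Ch-min _ _ _ CΔ-min _ _ = ⊕-minCover (maxWeight w ∸ h) Ch-min CΔ-min
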